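{- Consider any sequence of $m$ arc additions processed by the bidirectional-search method described in the context, with every search compatible. Then the total number of arcs traversed by all searches is $O(m^{3/2})$; that is, the amortized number of arcs traversed during searches is $O(m^{1/2})$ per arc addition.
   Context: Setting: a fixed finite vertex set $V$; initially no arcs; arcs are added one at a time, $m$ denoting the total number of arcs added (the process stops once a cycle is reported). A topological order is a total order $<$ of the vertices with $x<y$ for every arc $(x,y)$. The method maintains a total order $<$ of $V$ (initially arbitrary) and, for each vertex, its sets of outgoing and incoming arcs. To add $(v,w)$: add it to the incidence sets; if $v<w$ stop; if $v>w$ do a bidirectional search forward from $w$ and backward from $v$. A vertex is forward if it is $w$ or reached from $w$ by a path of arcs traversed forward, backward if it is $v$ or reached from $v$ by a path of arcs traversed backward; a forward (resp. backward) vertex is scanned if all its outgoing (resp. incoming) arcs have been traversed. The search stops and reports a cycle if a forward traversal reaches a backward vertex or a backward traversal reaches a forward vertex; otherwise it stops when there is a vertex $s$ such that all forward vertices less than $s$ and all backward vertices greater than $s$ are scanned, and then, with $X$ the forward vertices less than $s$ and $Y$ the backward vertices greater than $s$, the vertices of $X\cup Y$ are removed and reinserted just after $s$ (if $s$ is not forward) or just before $s$ (otherwise), in a topological order of the subgraph induced by $Y$ followed by a topological order of the subgraph induced by $X$. The search is restricted to the affected region: only arcs $(u,x)$ with $u<v$ are traversed forward and only arcs $(y,z)$ with $z>w$ are traversed backward. The search is balanced and compatible: it proceeds in traversal steps, each of which traverses one arc $(u,x)$ forward (with $u$ forward) and one arc $(y,z)$ backward (with $z$ backward) such that $u<z$ in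 the current order. -}

module Defs where

open import Data.Nat using (ℕ; zero; suc; _+_; _*_)
open import Data.Fin using (Fin)
open import Data.Fin.Properties using (_≟_)
open import Data.List using (List; []; _∷_; _++_; filter)
open import Data.List.Membership.Propositional using (_∈_; _∉_)
open import Data.List.Relation.Unary.Unique.Propositional using (Unique)
open import Data.Product using (Σ; ∃; _×_; _,_)
open import Data.Sum using (_⊎_)
open import Relation.Nullary using (¬_)
open import Relation.Nullary.Decidable using (¬?)
open import Relation.Binary.PropositionalEquality using (_≡_)

-- Vertices are Fin n; an arc is an ordered pair (tail , head).
-- A total order of the vertices is represented by a list (a permutation
-- of all vertices); x comes before y in the list iff x < y.

Arc : ℕ → Set
Arc n = Fin n × Fin n

Before : {A : Set} → List A → A → A → Set
Before L x y = ∃ λ l₁ → ∃ λ l₂ → ∃ λ l₃ → L ≡ l₁ ++ (x ∷ l₂ ++ (y ∷ l₃))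

_<[_]_ : {n : ℕ} → Fin n → List (Fin n) → Fin n → Set
x <[ o ] y = Before o x y

record SState (n : ℕ) : Set where
  constructor sstate
  field
    fwd  : List (Fin n)
    bwd  : List (Fin n)
    travF : List (Arc n)
    travB : List (Arc n)
open SState public

initSState : {n : ℕ} → Fin n → Fin n → SState n
initSState v w = sstate (w ∷ []) (v ∷ []) [] []

module _ {n : ℕ} (G : List (Arc n)) (o : List (Fin n)) (v w : Fin n) where

  open import Data.List.Membership.DecPropositional (_≟_ {n}) using () renaming (_∈?_ to _∈Fin?_)

  -- one traversal step: traverse (u,x) forward and (y,z) backward,
  -- restricted to the affected region, and compatible (u < z).
  Step : SState n → SState n → Set
  Step st st' =
    Σ (Fin n) λ u → Σ (Fin n) λ x → Σ (Fin n) λ y → Σ (Fin n) λ z →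
      ((u , x) ∈ G) × (u ∈ fwd st) × (u <[ o ] v) × ((u , x) ∉ travF st) ×
      ((y , z) ∈ G) × (z ∈ bwd st) × (w <[ o ] z) × ((y , z) ∉ travB st) ×
      (u <[ o ] z) ×
      (st' ≡ sstate (x ∷ fwd st) (y ∷ bwd st) ((u , x) ∷ travF st) ((y , z) ∷ travB st))

  ScannedF : SState n → Fin n → Set
  ScannedF st u = ∀ x → (u , x) ∈ G → (u , x) ∈ travF st

  ScannedB : SState n → Fin n → Set
  ScannedB st z = ∀ y → (y , z) ∈ G → (y , z) ∈ travB st

  CycleFound : SState n → Set
  CycleFound st = ∃ λ x → (x ∈ fwd st) × (x ∈ bwd st)

  Separator : SState n → Fin n → Set
  Separator st s =
    (∀ u → u ∈ fwd st → u <[ o ] s → ScannedF st u) ×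
    (∀ z → z ∈ bwd st → s <[ o ] z → ScannedB st z)

  Stopped : SState n → Set
  Stopped st = CycleFound st ⊎ ∃ (Separator st)

  data Search : SState n → SState n → ℕ → Set where
    done : ∀ {st} → Search st st 0
    step : ∀ {st st' st'' k} → ¬ Stopped st → Step st st' →
           Search st' st'' k → Search st st'' (suc k)

  TopoList : List (Fin n) → Set
  TopoList L = ∀ a b → (a , b) ∈ G → a ∈ L → b ∈ L → Before L a b

  Reorder : SState n → Fin n → List (Fin n) → Set
  Reorder st s o' =
    Σ (List (Fin n)) λ LX → Σ (List (Fin n)) λ LY →
    Σ (List (Fin n)) λ P → Σ (List (Fin n)) λ Q →
      Unique LX × (∀ x → (x ∈ LX → x ∈ fwd st × x <[ o ] s) × (x ∈ fwd st × x <[ o ] s → x ∈ LX)) ×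
      Unique LY × (∀ y → (y ∈ LY → y ∈ bwd st × s <[ o ] y) × (y ∈ bwd st × s <[ o ] y → y ∈ LY)) ×
      TopoList LX × TopoList LY ×
      (filter (λ x → ¬? (x ∈Fin? (LY ++ LX))) o ≡ P ++ (s ∷ Q)) ×
      (((s ∈ fwd st) × (o' ≡ P ++ (LY ++ (LX ++ (s ∷ Q))))) ⊎
       ((s ∉ fwd st) × (o' ≡ P ++ (s ∷ (LY ++ (LX ++ Q))))))

data Outcome (n : ℕ) : Set where
  continue : List (Fin n) → Outcome n
  cycle    : Outcome n

-- Process o G (v , w) r c : with current order o and arcs G, adding (v,w)
-- can yield result r while traversing c arcs in total.
data Process {n : ℕ} (o : List (Fin n)) (G : List (Arc n)) : Arc n → Outcome n → ℕ → Set where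
  forwardArc : ∀ {v w} → v <[ o ] w → Process o G (v , w) (continue o) 0
  selfLoop   : ∀ {v} → Process o G (v , v) cycle 0
  searchCycle : ∀ {v w st k} → w <[ o ] v →
    Search ((v , w) ∷ G) o v w (initSState v w) st k →
    CycleFound ((v , w) ∷ G) o v w st →
    Process o G (v , w) cycle (k + k)
  searchReorder : ∀ {v w st k s o'} → w <[ o ] v →
    Search ((v , w) ∷ G) o v w (initSState v w) st k →
    ¬ CycleFound ((v , w) ∷ G) o v w st →
    Separator ((v , w) ∷ G) o v w st s →
    Reorder ((v , w) ∷ G) o v w st s o' →
    Process o G (v , w) (continue o') (k + k)

data Run {n : ℕ} : List (Fin n) → List (Arc n) → List (Arc n) → ℕ → Set where
  finish : ∀ {o G} → Run o G [] 0
  next   : ∀ {o G a as o' c c'} → Process o G a (continue o') c →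
           Run o' (a ∷ G) as c' → Run o G (a ∷ as) (c + c')
  halt   : ∀ {o G a c} → Process o G a cycle c → Run o G (a ∷ []) c

module Submission where

-- Call a pair of arcs (e , f) related if the head of e reaches the tail of f; m arcs have at
-- most m² related pairs.  A search of k steps traverses forward arcs f₁ … f_k and backward arcs
-- b₁ … b_k with tail fᵢ < head bᵢ, so for all i, j one of (bᵢ , fⱼ), (bⱼ , fᵢ) has tail f < head b.
-- These ≥ k²/2 pairs are related through the new arc (v , w), but were not related before,
-- because the order was topological.  Hence Σ kᵢ² ≤ 2m², and by Cauchy–Schwarz the 2 Σ kᵢ
-- traversed arcs satisfy (2 Σ kᵢ)² ≤ 4 m Σ kᵢ² ≤ 8 m³.  The remaining ingredient is that each
-- reordering again yields a topological order.

open import Defs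
open import Data.Nat using (ℕ; zero; suc; _+_; _*_; _≤_; _<_; z≤n; s≤s; _<?_)
open import Data.Nat.Properties hiding (_≟_)
open import Data.Nat.ListAction using (sum)
open import Data.Nat.Tactic.RingSolver using (solve-∀)
open import Data.Fin using (Fin)
open import Data.Fin.Properties using (_≟_)
open import Data.List using (List; []; _∷_; _++_; [_]; length; map; filter; cartesianProduct; allFin)
open import Data.List.Properties using (++-assoc; length-++; length-map; map-++; filter-++; filter-accept; ++-identityʳ)
open import Data.List.Membership.Propositional using (_∈_; _∉_)
open import Data.List.Membership.Propositional.Properties
open import Data.List.Relation.Unary.Any using (here; there)
open import Data.List.Relation.Unary.All as All using (All; []; _∷_)
open import Data.List.Relation.Unary.All.Properties using (¬Any⇒All¬) renaming (++⁺ to All-++⁺)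
open import Data.List.Relation.Unary.AllPairs using ([]; _∷_)
open import Data.List.Relation.Unary.Unique.Propositional using (Unique)
open import Data.List.Relation.Unary.Unique.Propositional.Properties
  using (filter⁺; cartesianProduct⁺; allFin⁺) renaming (++⁺ to Unique-++⁺)
open import Data.List.Relation.Binary.Permutation.Propositional using (_↭_; ↭⇒↭ₛ; ↭-sym; ↭-trans; ↭-reflexive)
open import Data.List.Relation.Binary.Permutation.Propositional.Properties using (shift; shifts; ++⁺ˡ)
import Data.List.Relation.Binary.Permutation.Setoid.Properties as PermutationSetoid
open import Data.Product using (∃; _×_; _,_; proj₁; proj₂; uncurry)
open import Data.Sum using (_⊎_; inj₁; inj₂)
open import Data.Empty using (⊥; ⊥-elim)
open import Data.Unit using (⊤; tt)
open import Function using (_∘_)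
open import Relation.Nullary using (¬_; yes; no)
open import Relation.Nullary.Decidable using (¬?)
open import Relation.Unary using (Pred; Decidable)
open import Relation.Binary using (DecidableEquality)
open import Relation.Binary.Construct.Closure.ReflexiveTransitive using (Star; ε; _◅_; _◅◅_) renaming (map to Star-map)
open import Relation.Binary.PropositionalEquality hiding ([_])

private
  variable
    A B : Set

Before-here : ∀ {c y} {L : List A} → y ∈ L → Before (c ∷ L) c y
Before-here y∈L with l₂ , l₃ , refl ← ∈-∃++ y∈L = [] , l₂ , l₃ , refl

Before-there : ∀ {c x y} {L : List A} → Before L x y → Before (c ∷ L) x y
Before-there {c = c} (l₁ , l₂ , l₃ , refl) = c ∷ l₁ , l₂ , l₃ , refl

Before-++⁺ʳ : ∀ (P : List A) {L x y} → Before L x y → Before (P ++ L) x y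
Before-++⁺ʳ []      b = b
Before-++⁺ʳ (c ∷ P) b = Before-there (Before-++⁺ʳ P b)

Before-++⁺ˡ : ∀ {L : List A} (R : List A) {x y} → Before L x y → Before (L ++ R) x y
Before-++⁺ˡ R {x} {y} (l₁ , l₂ , l₃ , refl) = l₁ , l₂ , l₃ ++ R , (begin
  (l₁ ++ x ∷ l₂ ++ y ∷ l₃) ++ R  ≡⟨ ++-assoc l₁ _ R ⟩
  l₁ ++ x ∷ (l₂ ++ y ∷ l₃) ++ R  ≡⟨ cong (λ l → l₁ ++ x ∷ l) (++-assoc l₂ _ R) ⟩
  l₁ ++ x ∷ l₂ ++ y ∷ l₃ ++ R    ∎)
  where open ≡-Reasoning

Before-++⁺ : ∀ {P Q : List A} {x y} → x ∈ P → y ∈ Q → Before (P ++ Q) x y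
Before-++⁺ {P = _ ∷ P} (here refl) y∈Q = Before-here (∈-++⁺ʳ P y∈Q)
Before-++⁺ {P = _ ∷ P} (there x∈P) y∈Q = Before-there (Before-++⁺ x∈P y∈Q)

Before⇒∈ : ∀ {L : List A} {x y} → Before L x y → x ∈ L × y ∈ L
Before⇒∈ (l₁ , l₂ , l₃ , refl) = ∈-++⁺ʳ l₁ (here refl) , ∈-++⁺ʳ l₁ (there (∈-++⁺ʳ l₂ (here refl)))

¬Before-[] : ∀ {x y : A} → ¬ Before [] x y
¬Before-[] ([]    , _ , _ , ())
¬Before-[] (_ ∷ _ , _ , _ , ())

Before-∷⁻ : ∀ {c x y} {L : List A} → Before (c ∷ L) x y → (x ≡ c × y ∈ L) ⊎ Before L x y
Before-∷⁻ ([]     , l₂ , l₃ , refl) = inj₁ (refl , ∈-++⁺ʳ l₂ (here refl))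
Before-∷⁻ (_ ∷ l₁ , l₂ , l₃ , refl) = inj₂ (l₁ , l₂ , l₃ , refl)

Before-++⁻ : ∀ (P : List A) {Q x y} → Before (P ++ Q) x y →
             Before P x y ⊎ (x ∈ P × y ∈ Q) ⊎ Before Q x y
Before-++⁻ []      b = inj₂ (inj₂ b)
Before-++⁻ (c ∷ P) b with Before-∷⁻ b
... | inj₁ (refl , y∈) with ∈-++⁻ P y∈
...   | inj₁ y∈P = inj₁ (Before-here y∈P)
...   | inj₂ y∈Q = inj₂ (inj₁ (here refl , y∈Q))
Before-++⁻ (c ∷ P) b | inj₂ b′ with Before-++⁻ P b′
... | inj₁ bP                 = inj₁ (Before-there bP)
... | inj₂ (inj₁ (x∈P , y∈Q)) = inj₂ (inj₁ (there x∈P , y∈Q))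
... | inj₂ (inj₂ bQ)          = inj₂ (inj₂ bQ)

Before-insert : ∀ (P : List A) {M Q s x y} → s ∈ M →
                Before (P ++ s ∷ Q) x y → Before (P ++ M ++ Q) x y
Before-insert P {M} {Q} s∈M b with Before-++⁻ P b
... | inj₁ bP                         = Before-++⁺ˡ (M ++ Q) bP
... | inj₂ (inj₁ (x∈P , here refl))   = Before-++⁺ x∈P (∈-++⁺ˡ s∈M)
... | inj₂ (inj₁ (x∈P , there y∈Q))  = Before-++⁺ x∈P (∈-++⁺ʳ M y∈Q)
... | inj₂ (inj₂ bsQ) with Before-∷⁻ bsQ
...   | inj₁ (refl , y∈Q) = Before-++⁺ʳ P (Before-++⁺ s∈M y∈Q)
...   | inj₂ bQ           = Before-++⁺ʳ P (Before-++⁺ʳ M bQ)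

module _ {p} {P : Pred A p} (P? : Decidable P) where

  Before-filter⁺ : ∀ {L x y} → P x → P y → Before L x y → Before (filter P? L) x y
  Before-filter⁺ {[]}    px py b = ⊥-elim (¬Before-[] b)
  Before-filter⁺ {c ∷ L} px py b with Before-∷⁻ b | P? c
  ... | inj₁ (refl , y∈) | yes _ = Before-here (∈-filter⁺ P? y∈ py)
  ... | inj₁ (refl , y∈) | no ¬pc = ⊥-elim (¬pc px)
  ... | inj₂ b′ | yes _ = Before-there (Before-filter⁺ px py b′)
  ... | inj₂ b′ | no _  = Before-filter⁺ px py b′

  Before-filter⁻ : ∀ {L x y} → Before (filter P? L) x y → Before L x y
  Before-filter⁻ {[]}    b = ⊥-elim (¬Before-[] b)
  Before-filter⁻ {c ∷ L} b with P? c
  ... | no _ = Before-there (Before-filter⁻ b)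
  ... | yes _ with Before-∷⁻ b
  ...   | inj₁ (refl , y∈) = Before-here (proj₁ (∈-filter⁻ P? y∈))
  ...   | inj₂ b′          = Before-there (Before-filter⁻ b′)

Unique-resp-↭ : ∀ {xs ys : List A} → xs ↭ ys → Unique xs → Unique ys
Unique-resp-↭ {A} p = PermutationSetoid.Unique-resp-↭ (setoid A) (↭⇒↭ₛ p)

-- Sf (resp. Sb) is the condition under which the block N is placed before (resp. after) s.
record Placement (P N Q : List A) (s : A) (Sf Sb : Set) (o′ : List A) : Set where
  field
    rest-kept   : ∀ {a b} → Before (P ++ s ∷ Q) a b → Before o′ a b
    block-kept  : ∀ {a b} → Before N a b → Before o′ a b
    P<N         : ∀ {a b} → a ∈ P → b ∈ N → Before o′ a b
    N<Q         : ∀ {a b} → a ∈ N → b ∈ Q → Before o′ a b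
    N<s         : ∀ {a} → Sf → a ∈ N → Before o′ a s
    s<N         : ∀ {b} → Sb → b ∈ N → Before o′ s b
    permutation : o′ ↭ N ++ P ++ s ∷ Q

placement : ∀ (P : List A) {N Q s Sf Sb} M → s ∈ M → (∀ {x} → x ∈ N → x ∈ M) →
            (∀ {a b} → Before N a b → Before M a b) →
            (Sf → ∀ {a} → a ∈ N → Before M a s) → (Sb → ∀ {b} → b ∈ N → Before M s b) →
            M ++ Q ↭ N ++ s ∷ Q → Placement P N Q s Sf Sb (P ++ M ++ Q)
placement P {N} {Q} M s∈M N⊆M N→M N<s s<N perm = record
  { rest-kept   = Before-insert P s∈M
  ; block-kept  = inside ∘ N→M
  ; P<N         = λ a∈P b∈N → Before-++⁺ a∈P (∈-++⁺ˡ (N⊆M b∈N))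
  ; N<Q         = λ a∈N b∈Q → Before-++⁺ʳ P (Before-++⁺ (N⊆M a∈N) b∈Q)
  ; N<s         = λ sf a∈N → inside (N<s sf a∈N)
  ; s<N         = λ sb b∈N → inside (s<N sb b∈N)
  ; permutation = ↭-trans (++⁺ˡ P perm) (shifts P N)
  }
  where
  inside : ∀ {a b} → Before M a b → Before (P ++ M ++ Q) a b
  inside = Before-++⁺ʳ P ∘ Before-++⁺ˡ Q

placement-after : ∀ (P N Q : List A) {s Sf Sb} → ¬ Sb →
                  Placement P N Q s Sf Sb (P ++ (N ++ [ s ]) ++ Q)
placement-after P N Q ¬sb = placement P (N ++ [ _ ]) (∈-++⁺ʳ N (here refl)) ∈-++⁺ˡ (Before-++⁺ˡ _)
  (λ _ a∈N → Before-++⁺ a∈N (here refl)) (⊥-elim ∘ ¬sb) (↭-reflexive (++-assoc N _ Q))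

placement-before : ∀ (P N Q : List A) {s Sf Sb} → ¬ Sf →
                   Placement P N Q s Sf Sb (P ++ (s ∷ N) ++ Q)
placement-before P N Q ¬sf = placement P (_ ∷ N) (here refl) there Before-there
  (⊥-elim ∘ ¬sf) (λ _ b∈N → Before-here b∈N) (↭-sym (shift _ N Q))

module PositionIn (_≟ᴬ_ : DecidableEquality A) where

  position : List A → A → ℕ
  position []      x = 0
  position (c ∷ L) x with x ≟ᴬ c
  ... | yes _ = 0
  ... | no _  = suc (position L x)

  Before⇒position< : ∀ {L a b} → Unique L → Before L a b → position L a < position L b
  Before⇒position< {a = a} {b} (a∉ ∷ _) ([] , l₂ , l₃ , refl) with a ≟ᴬ a | b ≟ᴬ a
  ... | no a≢a | _      = ⊥-elim (a≢a refl)
  ... | yes _  | no _   = s≤s z≤n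
  ... | yes _  | yes refl = ⊥-elim (All.lookup a∉ (∈-++⁺ʳ l₂ (here refl)) refl)
  Before⇒position< {a = a} {b} (c∉ ∷ u) (c ∷ l₁ , l₂ , l₃ , refl) with a ≟ᴬ c | b ≟ᴬ c
  ... | yes refl | _ = ⊥-elim (All.lookup c∉ (∈-++⁺ʳ l₁ (here refl)) refl)
  ... | no _ | yes refl = ⊥-elim (All.lookup c∉ (∈-++⁺ʳ l₁ (there (∈-++⁺ʳ l₂ (here refl)))) refl)
  ... | no _ | no _ = s≤s (Before⇒position< u (l₁ , l₂ , l₃ , refl))

crossed-< : ∀ {a b c d} → a < b → c < d → c < b ⊎ a < d
crossed-< {a} {b} {c} {d} a<b c<d with c <? b
... | yes c<b = inj₁ c<b
... | no c≮b  = inj₂ (<-≤-trans a<b (≤-trans (≮⇒≥ c≮b) (<⇒≤ c<d)))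

+-exchange : ∀ p q r s → (p + q) + (r + s) ≡ (p + r) + (q + s)
+-exchange = solve-∀

module Inversions (lo : A → ℕ) (hi : B → ℕ) where

  Compatible : A × B → Set
  Compatible (a , b) = lo a < hi b

  Inverted : B × A → Set
  Inverted (b , a) = lo a < hi b

  inverted? : Decidable Inverted
  inverted? (b , a) = lo a <? hi b

  count : List (B × A) → ℕ
  count = length ∘ filter inverted?

  inversions : List (A × B) → List (B × A)
  inversions L = filter inverted? (cartesianProduct (map proj₂ L) (map proj₁ L))

  ∈-inversions⁻ : ∀ {L b a} → (b , a) ∈ inversions L →
                  b ∈ map proj₂ L × a ∈ map proj₁ L × Inverted (b , a)
  ∈-inversions⁻ {L} x∈
    with x∈grid , inv ← ∈-filter⁻ inverted? {xs = cartesianProduct (map proj₂ L) (map proj₁ L)} x∈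
    with b∈ , a∈ ← ∈-cartesianProduct⁻ (map proj₂ L) (map proj₁ L) x∈grid = b∈ , a∈ , inv

  count-++ : ∀ xs ys → count (xs ++ ys) ≡ count xs + count ys
  count-++ xs ys = trans (cong length (filter-++ inverted? xs ys)) (length-++ (filter inverted? xs))

  inverted⇒1≤count : ∀ {x} → Inverted x → 1 ≤ count [ x ]
  inverted⇒1≤count {x} inv = ≤-reflexive (cong length (sym (filter-accept inverted? {x} {[]} inv)))

  count-cartesianProduct-∷ʳ : ∀ bs a as → count (cartesianProduct bs (a ∷ as)) ≡
                              count (map (_, a) bs) + count (cartesianProduct bs as)
  count-cartesianProduct-∷ʳ []       a as = refl
  count-cartesianProduct-∷ʳ (b ∷ bs) a as = begin
    count ((b , a) ∷ map (b ,_) as ++ cartesianProduct bs (a ∷ as))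
      ≡⟨ count-++ ((b , a) ∷ map (b ,_) as) _ ⟩
    count ((b , a) ∷ map (b ,_) as) + count (cartesianProduct bs (a ∷ as))
      ≡⟨ cong₂ _+_ (count-++ [ b , a ] (map (b ,_) as)) (count-cartesianProduct-∷ʳ bs a as) ⟩
    (count [ b , a ] + count (map (b ,_) as)) + (count (map (_, a) bs) + count (cartesianProduct bs as))
      ≡⟨ +-exchange (count [ b , a ]) _ _ _ ⟩
    (count [ b , a ] + count (map (_, a) bs)) + (count (map (b ,_) as) + count (cartesianProduct bs as))
      ≡⟨ cong₂ _+_ (sym (count-++ [ b , a ] (map (_, a) bs))) (sym (count-++ (map (b ,_) as) _)) ⟩
    count (map (_, a) (b ∷ bs)) + count (cartesianProduct (b ∷ bs) as)
      ∎
    where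
    open ≡-Reasoning

  -- Of the two crossed pairs (b , a′) and (b′ , a), at least one is inverted.
  crossed-pairs : ∀ {a b} → Compatible (a , b) → ∀ L → All Compatible L →
                  length L ≤ count (map (b ,_) (map proj₁ L)) + count (map (_, a) (map proj₂ L))
  crossed-pairs ab [] [] = z≤n
  crossed-pairs {a} {b} ab ((a′ , b′) ∷ L) (a′b′ ∷ cL) = begin
    suc (length L)
      ≤⟨ +-mono-≤ one-inverted (crossed-pairs ab L cL) ⟩
    (count [ b , a′ ] + count [ b′ , a ]) + (count (map (b ,_) as) + count (map (_, a) bs))
      ≡⟨ +-exchange (count [ b , a′ ]) _ _ _ ⟩
    (count [ b , a′ ] + count (map (b ,_) as)) + (count [ b′ , a ] + count (map (_, a) bs))
      ≡⟨ sym (cong₂ _+_ (count-++ [ b , a′ ] _) (count-++ [ b′ , a ] _)) ⟩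
    count (map (b ,_) (a′ ∷ as)) + count (map (_, a) (b′ ∷ bs))
      ∎
    where
    open ≤-Reasoning
    as : List A
    as = map proj₁ L
    bs : List B
    bs = map proj₂ L
    one-inverted : 1 ≤ count [ b , a′ ] + count [ b′ , a ]
    one-inverted with crossed-< ab a′b′
    ... | inj₁ inv = ≤-trans (inverted⇒1≤count inv) (m≤m+n _ _)
    ... | inj₂ inv = ≤-trans (inverted⇒1≤count inv) (m≤n+m _ _)

  length²+length≤2*inversions : ∀ L → All Compatible L →
                                 length L * length L + length L ≤ 2 * length (inversions L)
  length²+length≤2*inversions []            []         = z≤n
  length²+length≤2*inversions ((a , b) ∷ L) (ab ∷ cL) = begin
    suc k * suc k + suc k
      ≡⟨ expand k ⟩
    2 * (1 + k) + (k * k + k)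
      ≤⟨ +-mono-≤ (*-monoʳ-≤ 2 (+-mono-≤ (inverted⇒1≤count ab) (crossed-pairs ab L cL)))
                  (length²+length≤2*inversions L cL) ⟩
    2 * (count [ b , a ] + (count (map (b ,_) as) + count (map (_, a) bs))) + 2 * count (cartesianProduct bs as)
      ≡⟨ regroup (count [ b , a ]) _ _ _ ⟩
    2 * ((count [ b , a ] + count (map (b ,_) as)) + (count (map (_, a) bs) + count (cartesianProduct bs as)))
      ≡⟨ cong (λ t → 2 * t) (sym (cong₂ _+_ (count-++ [ b , a ] _) (count-cartesianProduct-∷ʳ bs a as))) ⟩
    2 * (count (map (b ,_) (a ∷ as)) + count (cartesianProduct bs (a ∷ as)))
      ≡⟨ cong (λ t → 2 * t) (sym (count-++ (map (b ,_) (a ∷ as)) _)) ⟩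
    2 * count (cartesianProduct (b ∷ bs) (a ∷ as))
      ∎
    where
    open ≤-Reasoning
    k : ℕ
    k = length L
    as : List A
    as = map proj₁ L
    bs : List B
    bs = map proj₂ L
    expand : ∀ k → suc k * suc k + suc k ≡ 2 * (1 + k) + (k * k + k)
    expand = solve-∀
    regroup : ∀ p q r s → 2 * (p + (q + r)) + 2 * s ≡ 2 * ((p + q) + (r + s))
    regroup = solve-∀

  length²≤2*inversions : ∀ L → All Compatible L → length L * length L ≤ 2 * length (inversions L)
  length²≤2*inversions L cL = ≤-trans (m≤m+n _ (length L)) (length²+length≤2*inversions L cL)

module _ {n : ℕ} where

  open PositionIn (_≟_ {n}) public

  Reach : List (Arc n) → Fin n → Fin n → Set
  Reach G = Star (λ a b → (a , b) ∈ G)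

  TopologicalOrder : List (Fin n) → List (Arc n) → Set
  TopologicalOrder o G = Unique o × (∀ {a b} → (a , b) ∈ G → Before o a b)

  Reach⇒position≤ : ∀ {o G a b} → TopologicalOrder o G → Reach G a b → position o a ≤ position o b
  Reach⇒position≤ topo ε        = ≤-refl
  Reach⇒position≤ topo (e ◅ r) =
    <⇒≤ (<-≤-trans (Before⇒position< (proj₁ topo) (proj₂ topo e)) (Reach⇒position≤ topo r))

module SearchTrace {n : ℕ} (H : List (Arc n)) (o : List (Fin n)) (v w : Fin n) where

  record SearchInvariant (st : SState n) : Set where
    field
      fwd-reached  : ∀ {x} → x ∈ fwd st → Reach H w x
      bwd-reaching : ∀ {y} → y ∈ bwd st → Reach H y v
      travF-fwd    : ∀ {a b} → (a , b) ∈ travF st → b ∈ fwd st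
      travB-bwd    : ∀ {a b} → (a , b) ∈ travB st → a ∈ bwd st
      travF-unique : Unique (travF st)
      travB-unique : Unique (travB st)
      w∈fwd        : w ∈ fwd st
      v∈bwd        : v ∈ bwd st
  open SearchInvariant public

  initial-invariant : SearchInvariant (initSState v w)
  initial-invariant = record
    { fwd-reached  = λ { (here refl) → ε }
    ; bwd-reaching = λ { (here refl) → ε }
    ; travF-fwd    = λ ()
    ; travB-bwd    = λ ()
    ; travF-unique = []
    ; travB-unique = []
    ; w∈fwd        = here refl
    ; v∈bwd        = here refl
    }

  step-invariant : ∀ {st st′} → Step H o v w st st′ → SearchInvariant st → SearchInvariant st′
  step-invariant (u , x , y , z , ux∈ , u∈ , _ , ux∉ , yz∈ , z∈ , _ , yz∉ , _ , refl) si = record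
    { fwd-reached  = λ { (here refl) → fwd-reached si u∈ ◅◅ ux∈ ◅ ε ; (there p) → fwd-reached si p }
    ; bwd-reaching = λ { (here refl) → yz∈ ◅ bwd-reaching si z∈ ; (there p) → bwd-reaching si p }
    ; travF-fwd    = λ { (here refl) → here refl ; (there p) → there (travF-fwd si p) }
    ; travB-bwd    = λ { (here refl) → here refl ; (there p) → there (travB-bwd si p) }
    ; travF-unique = ¬Any⇒All¬ _ ux∉ ∷ travF-unique si
    ; travB-unique = ¬Any⇒All¬ _ yz∉ ∷ travB-unique si
    ; w∈fwd        = there (w∈fwd si)
    ; v∈bwd        = there (v∈bwd si)
    }

  search-invariant : ∀ {st st′ k} → Search H o v w st st′ k → SearchInvariant st → SearchInvariant st′
  search-invariant done              si = si
  search-invariant (step _ st→st′ rest) si = search-invariant rest (step-invariant st→st′ si)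

  record TraversedPair (f b : Arc n) : Set where
    field
      fwd-arc    : f ∈ H
      bwd-arc    : b ∈ H
      w⇝tail     : Reach H w (proj₁ f)
      head⇝v     : Reach H (proj₂ b) v
      compatible : position o (proj₁ f) < position o (proj₂ b)
  open TraversedPair public

  record Trace (st st′ : SState n) (k : ℕ) : Set where
    field
      steps          : List (Arc n × Arc n)
      length-steps   : length steps ≡ k
      travF-steps    : travF st′ ≡ map proj₁ steps ++ travF st
      travB-steps    : travB st′ ≡ map proj₂ steps ++ travB st
      steps-traversed : All (uncurry TraversedPair) steps
  open Trace public

  trace-∷ : ∀ {st st′ st″ k f b} → travF st′ ≡ f ∷ travF st → travB st′ ≡ b ∷ travB st →
            TraversedPair f b → Trace st′ st″ k → Trace st st″ (suc k)
  trace-∷ {st} {f = f} {b} F-eq B-eq fb tr = record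
    { steps           = steps tr ++ [ f , b ]
    ; length-steps    = trans (length-++ (steps tr)) (trans (+-comm _ 1) (cong suc (length-steps tr)))
    ; travF-steps     = trans (travF-steps tr) (trans (cong (map proj₁ (steps tr) ++_) F-eq) (snoc proj₁ (travF st)))
    ; travB-steps     = trans (travB-steps tr) (trans (cong (map proj₂ (steps tr) ++_) B-eq) (snoc proj₂ (travB st)))
    ; steps-traversed = All-++⁺ (steps-traversed tr) (fb ∷ [])
    }
    where
    snoc : (g : Arc n × Arc n → Arc n) (t : List (Arc n)) →
           map g (steps tr) ++ g (f , b) ∷ t ≡ map g (steps tr ++ [ f , b ]) ++ t
    snoc g t = trans (sym (++-assoc (map g (steps tr)) _ t)) (cong (_++ t) (sym (map-++ g (steps tr) [ f , b ])))

  search-trace : ∀ {st st′ k} → Unique o → Search H o v w st st′ k → SearchInvariant st → Trace st st′ k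
  search-trace uo done si = record
    { steps = [] ; length-steps = refl ; travF-steps = refl ; travB-steps = refl ; steps-traversed = [] }
  search-trace uo (step _ st→st′@(u , x , y , z , ux∈ , u∈ , _ , _ , yz∈ , z∈ , _ , _ , u<z , refl) rest) si =
    trace-∷ refl refl traversed (search-trace uo rest (step-invariant st→st′ si))
    where
    traversed : TraversedPair (u , x) (y , z)
    traversed = record
      { fwd-arc = ux∈ ; bwd-arc = yz∈ ; w⇝tail = fwd-reached si u∈ ; head⇝v = bwd-reaching si z∈
      ; compatible = Before⇒position< uo u<z }

module Reordering {n : ℕ} {G : List (Arc n)} {o : List (Fin n)} {v w : Fin n}
                  (topo : TopologicalOrder o G) (w<v : w <[ o ] v) where

  open import Data.List.Membership.DecPropositional (_≟_ {n}) using (_∈?_)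

  H : List (Arc n)
  H = (v , w) ∷ G

  open SearchTrace H o v w using (SearchInvariant; travF-fwd; travB-bwd; w∈fwd; v∈bwd)

  pos< : ∀ {a b} → Before o a b → position o a < position o b
  pos< = Before⇒position< (proj₁ topo)

  module Blocks {st : SState n} (si : SearchInvariant st) (no-cycle : ¬ CycleFound H o v w st)
              {s : Fin n} (sep : Separator H o v w st s) {LX LY P Q : List (Fin n)}
              (uLX : Unique LX)
              (specX : ∀ x → (x ∈ LX → x ∈ fwd st × x <[ o ] s) × (x ∈ fwd st × x <[ o ] s → x ∈ LX))
              (uLY : Unique LY)
              (specY : ∀ y → (y ∈ LY → y ∈ bwd st × s <[ o ] y) × (y ∈ bwd st × s <[ o ] y → y ∈ LY))
              (topX : TopoList H o v w LX) (topY : TopoList H o v w LY)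
              (rest : filter (λ x → ¬? (x ∈? (LY ++ LX))) o ≡ P ++ s ∷ Q) where

    N R : List (Fin n)
    N = LY ++ LX
    R = P ++ s ∷ Q

    outside? : Decidable (_∉ N)
    outside? x = ¬? (x ∈? N)

    fwd-bwd-disjoint : ∀ {x} → x ∈ fwd st → x ∈ bwd st → ⊥
    fwd-bwd-disjoint x∈F x∈B = no-cycle (_ , x∈F , x∈B)

    X-fwd : ∀ {x} → x ∈ LX → x ∈ fwd st
    X-fwd = proj₁ ∘ proj₁ (specX _)
    X<s : ∀ {x} → x ∈ LX → x <[ o ] s
    X<s = proj₂ ∘ proj₁ (specX _)
    Y-bwd : ∀ {y} → y ∈ LY → y ∈ bwd st
    Y-bwd = proj₁ ∘ proj₁ (specY _)
    s<Y : ∀ {y} → y ∈ LY → s <[ o ] y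
    s<Y = proj₂ ∘ proj₁ (specY _)

    X⊆N : ∀ {x} → x ∈ LX → x ∈ N
    X⊆N = ∈-++⁺ʳ LY
    Y⊆N : ∀ {x} → x ∈ LY → x ∈ N
    Y⊆N = ∈-++⁺ˡ

    ∉N : ∀ {x} → x ∉ LY → x ∉ LX → x ∉ N
    ∉N x∉Y x∉X x∈N with ∈-++⁻ LY x∈N
    ... | inj₁ x∈Y = x∉Y x∈Y
    ... | inj₂ x∈X = x∉X x∈X

    R-outside : ∀ {x} → x ∈ R → x ∈ o × x ∉ N
    R-outside x∈R = ∈-filter⁻ outside? {xs = o} (subst (_ ∈_) (sym rest) x∈R)

    rest⁺ : ∀ {a b} → a ∈ R → b ∈ R → Before o a b → Before R a b
    rest⁺ a∈R b∈R = subst (λ L → Before L _ _) rest ∘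
                    Before-filter⁺ outside? (proj₂ (R-outside a∈R)) (proj₂ (R-outside b∈R))

    rest⁻ : ∀ {a b} → Before R a b → Before o a b
    rest⁻ = Before-filter⁻ outside? ∘ subst (λ L → Before L _ _) (sym rest)

    P<s : ∀ {x} → x ∈ P → x <[ o ] s
    P<s x∈P = rest⁻ (Before-++⁺ x∈P (here refl))
    s<Q : ∀ {x} → x ∈ Q → s <[ o ] x
    s<Q x∈Q = rest⁻ (Before-++⁺ʳ P (Before-here x∈Q))

    -- A forward vertex in P would lie before s, hence in X; dually for Q.
    fwd∉P : ∀ {x} → x ∈ fwd st → x ∉ P
    fwd∉P x∈F x∈P = proj₂ (R-outside (∈-++⁺ˡ x∈P)) (X⊆N (proj₂ (specX _) (x∈F , P<s x∈P)))
    bwd∉Q : ∀ {x} → x ∈ bwd st → x ∉ Q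
    bwd∉Q x∈B x∈Q = proj₂ (R-outside (∈-++⁺ʳ P (there x∈Q))) (Y⊆N (proj₂ (specY _) (x∈B , s<Q x∈Q)))

    X-scanned : ∀ {a b} → a ∈ LX → (a , b) ∈ G → b ∈ fwd st
    X-scanned a∈X e = travF-fwd si (proj₁ sep _ (X-fwd a∈X) (X<s a∈X) _ (there e))
    Y-scanned : ∀ {a b} → b ∈ LY → (a , b) ∈ G → a ∈ bwd st
    Y-scanned b∈Y e = travB-bwd si (proj₂ sep _ (Y-bwd b∈Y) (s<Y b∈Y) _ (there e))

    asym : ∀ {a b} → a <[ o ] b → b <[ o ] a → ⊥
    asym ab ba = <-asym (pos< ab) (pos< ba)
    cyclic : ∀ {a b c} → a <[ o ] b → b <[ o ] c → c <[ o ] a → ⊥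
    cyclic ab bc ca = <-irrefl refl (<-trans (pos< ab) (<-trans (pos< bc) (pos< ca)))

    data Block : Fin n → Set where
      inX : ∀ {x} → x ∈ LX → Block x
      inY : ∀ {x} → x ∈ LY → Block x
      inP : ∀ {x} → x ∈ P → Block x
      atS : Block s
      inQ : ∀ {x} → x ∈ Q → Block x

    block : ∀ {x} → x ∈ o → Block x
    block {x} x∈o with x ∈? LX | x ∈? LY
    ... | yes x∈X | _       = inX x∈X
    ... | no _    | yes x∈Y = inY x∈Y
    ... | no x∉X  | no x∉Y with ∈-++⁻ P (subst (x ∈_) rest (∈-filter⁺ outside? x∈o (∉N x∉Y x∉X)))
    ...   | inj₁ x∈P         = inP x∈P
    ...   | inj₂ (here refl) = atS
    ...   | inj₂ (there x∈Q) = inQ x∈Q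

    unique-N++R : Unique (N ++ R)
    unique-N++R = Unique-++⁺ (Unique-++⁺ uLY uLX λ (y∈Y , y∈X) → fwd-bwd-disjoint (X-fwd y∈X) (Y-bwd y∈Y))
                             (subst Unique rest (filter⁺ outside? (proj₁ topo)))
                             (λ (x∈N , x∈R) → proj₂ (R-outside x∈R) x∈N)

    module Arcs {o′ : List (Fin n)} (pl : Placement P N Q s (s ∈ fwd st) (s ∈ bwd st) o′) where
      open Placement pl

      kept : ∀ {a b} → (a , b) ∈ G → a ∈ R → b ∈ R → Before o′ a b
      kept e a∈R b∈R = rest-kept (rest⁺ a∈R b∈R (proj₂ topo e))

      old-arc : ∀ {a b} → (a , b) ∈ G → Block a → Block b → Before o′ a b
      old-arc e (inX a∈X) (inX b∈X) = block-kept (Before-++⁺ʳ LY (topX _ _ (there e) a∈X b∈X))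
      old-arc e (inX a∈X) (inY b∈Y) = ⊥-elim (fwd-bwd-disjoint (X-scanned a∈X e) (Y-bwd b∈Y))
      old-arc e (inX a∈X) (inP b∈P) = ⊥-elim (fwd∉P (X-scanned a∈X e) b∈P)
      old-arc e (inX a∈X) atS       = N<s (X-scanned a∈X e) (X⊆N a∈X)
      old-arc e (inX a∈X) (inQ b∈Q) = N<Q (X⊆N a∈X) b∈Q
      old-arc e (inY a∈Y) (inX b∈X) = block-kept (Before-++⁺ a∈Y b∈X)
      old-arc e (inY a∈Y) (inY b∈Y) = block-kept (Before-++⁺ˡ LX (topY _ _ (there e) a∈Y b∈Y))
      old-arc e (inY a∈Y) (inP b∈P) = ⊥-elim (cyclic (s<Y a∈Y) (proj₂ topo e) (P<s b∈P))
      old-arc e (inY a∈Y) atS       = ⊥-elim (asym (s<Y a∈Y) (proj₂ topo e))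
      old-arc e (inY a∈Y) (inQ b∈Q) = N<Q (Y⊆N a∈Y) b∈Q
      old-arc e (inP a∈P) (inX b∈X) = P<N a∈P (X⊆N b∈X)
      old-arc e (inP a∈P) (inY b∈Y) = P<N a∈P (Y⊆N b∈Y)
      old-arc e (inP a∈P) (inP b∈P) = kept e (∈-++⁺ˡ a∈P) (∈-++⁺ˡ b∈P)
      old-arc e (inP a∈P) atS       = kept e (∈-++⁺ˡ a∈P) (∈-++⁺ʳ P (here refl))
      old-arc e (inP a∈P) (inQ b∈Q) = kept e (∈-++⁺ˡ a∈P) (∈-++⁺ʳ P (there b∈Q))
      old-arc e atS       (inX b∈X) = ⊥-elim (asym (proj₂ topo e) (X<s b∈X))
      old-arc e atS       (inY b∈Y) = s<N (Y-scanned b∈Y e) (Y⊆N b∈Y)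
      old-arc e atS       (inP b∈P) = kept e (∈-++⁺ʳ P (here refl)) (∈-++⁺ˡ b∈P)
      old-arc e atS       atS       = kept e (∈-++⁺ʳ P (here refl)) (∈-++⁺ʳ P (here refl))
      old-arc e atS       (inQ b∈Q) = kept e (∈-++⁺ʳ P (here refl)) (∈-++⁺ʳ P (there b∈Q))
      old-arc e (inQ a∈Q) (inX b∈X) = ⊥-elim (cyclic (s<Q a∈Q) (proj₂ topo e) (X<s b∈X))
      old-arc e (inQ a∈Q) (inY b∈Y) = ⊥-elim (bwd∉Q (Y-scanned b∈Y e) a∈Q)
      old-arc e (inQ a∈Q) (inP b∈P) = kept e (∈-++⁺ʳ P (there a∈Q)) (∈-++⁺ˡ b∈P)
      old-arc e (inQ a∈Q) atS       = kept e (∈-++⁺ʳ P (there a∈Q)) (∈-++⁺ʳ P (here refl))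
      old-arc e (inQ a∈Q) (inQ b∈Q) = kept e (∈-++⁺ʳ P (there a∈Q)) (∈-++⁺ʳ P (there b∈Q))

      new-arc : Block v → Block w → Before o′ v w
      new-arc (inX v∈X) _         = ⊥-elim (fwd-bwd-disjoint (X-fwd v∈X) (v∈bwd si))
      new-arc (inQ v∈Q) _         = ⊥-elim (bwd∉Q (v∈bwd si) v∈Q)
      new-arc _         (inY w∈Y) = ⊥-elim (fwd-bwd-disjoint (w∈fwd si) (Y-bwd w∈Y))
      new-arc _         (inP w∈P) = ⊥-elim (fwd∉P (w∈fwd si) w∈P)
      new-arc (inY v∈Y) (inX w∈X) = block-kept (Before-++⁺ v∈Y w∈X)
      new-arc (inY v∈Y) atS       = N<s (w∈fwd si) (Y⊆N v∈Y)
      new-arc (inY v∈Y) (inQ w∈Q) = N<Q (Y⊆N v∈Y) w∈Q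
      new-arc (inP v∈P) (inX w∈X) = P<N v∈P (X⊆N w∈X)
      new-arc (inP v∈P) atS       = ⊥-elim (asym (P<s v∈P) w<v)
      new-arc (inP v∈P) (inQ w∈Q) = ⊥-elim (cyclic (P<s v∈P) (s<Q w∈Q) w<v)
      new-arc atS       (inX w∈X) = s<N (v∈bwd si) (X⊆N w∈X)
      new-arc atS       atS       = ⊥-elim (<-irrefl refl (pos< w<v))
      new-arc atS       (inQ w∈Q) = ⊥-elim (asym (s<Q w∈Q) w<v)

      topological : TopologicalOrder o′ H
      topological = Unique-resp-↭ (↭-sym permutation) unique-N++R , arc
        where
        arc : ∀ {a b} → (a , b) ∈ H → Before o′ a b
        arc (here refl) = new-arc (block (proj₂ (Before⇒∈ w<v))) (block (proj₁ (Before⇒∈ w<v)))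
        arc (there e)   = old-arc e (block (proj₁ (Before⇒∈ (proj₂ topo e))))
                                    (block (proj₂ (Before⇒∈ (proj₂ topo e))))

  reorder-topological : ∀ {st s o′} → SearchInvariant st → ¬ CycleFound H o v w st →
                        Separator H o v w st s → Reorder H o v w st s o′ → TopologicalOrder o′ H
  reorder-topological {s = s} si nc sep
    (LX , LY , P , Q , uLX , specX , uLY , specY , topX , topY , rest , inj₁ (s∈F , refl)) =
    subst (λ o′ → TopologicalOrder o′ H) (cong (P ++_) regroup)
          (Arcs.topological (placement-after P N Q λ s∈B → nc (s , s∈F , s∈B)))
    where
    open Blocks si nc sep uLX specX uLY specY topX topY rest
    regroup : (N ++ [ s ]) ++ Q ≡ LY ++ LX ++ s ∷ Q
    regroup = trans (++-assoc N [ s ] Q) (++-assoc LY LX (s ∷ Q))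
  reorder-topological {s = s} si nc sep
    (LX , LY , P , Q , uLX , specX , uLY , specY , topX , topY , rest , inj₂ (s∉F , refl)) =
    subst (λ o′ → TopologicalOrder o′ H) (cong (λ l → P ++ s ∷ l) (++-assoc LY LX Q))
          (Arcs.topological (placement-before P N Q s∉F))
    where open Blocks si nc sep uLX specX uLY specY topX topY rest

module _ {n : ℕ} where

  Related : List (Arc n) → Arc n × Arc n → Set
  Related G (e , f) = e ∈ G × f ∈ G × Reach G (proj₂ e) (proj₁ f)

  Related-∷ : ∀ {G a p} → Related G p → Related (a ∷ G) p
  Related-∷ (e∈ , f∈ , r) = there e∈ , there f∈ , Star-map there r

module NewPairs {n : ℕ} {G : List (Arc n)} {o : List (Fin n)} {v w : Fin n} (topo : TopologicalOrder o G)
                {st : SState n} {k : ℕ} (search : Search ((v , w) ∷ G) o v w (initSState v w) st k) where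

  H : List (Arc n)
  H = (v , w) ∷ G

  open SearchTrace H o v w
  open Inversions {A = Arc n} {B = Arc n} (position o ∘ proj₁) (position o ∘ proj₂)

  trace : Trace (initSState v w) st k
  trace = search-trace (proj₁ topo) search initial-invariant

  new-pairs : List (Arc n × Arc n)
  new-pairs = inversions (steps trace)

  new-pairs-unique : Unique new-pairs
  new-pairs-unique = filter⁺ inverted? (cartesianProduct⁺ traversedB-unique traversedF-unique)
    where
    final : SearchInvariant st
    final = search-invariant search initial-invariant
    traversedF-unique : Unique (map proj₁ (steps trace))
    traversedF-unique = subst Unique (trans (travF-steps trace) (++-identityʳ _)) (travF-unique final)
    traversedB-unique : Unique (map proj₂ (steps trace))
    traversedB-unique = subst Unique (trans (travB-steps trace) (++-identityʳ _)) (travB-unique final)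

  traversed-fwd : ∀ {f} → f ∈ map proj₁ (steps trace) → Reach H w (proj₁ f) × f ∈ H
  traversed-fwd f∈ with p , p∈ , refl ← ∈-map⁻ proj₁ f∈
    = let t = All.lookup (steps-traversed trace) p∈ in w⇝tail t , fwd-arc t

  traversed-bwd : ∀ {b} → b ∈ map proj₂ (steps trace) → Reach H (proj₂ b) v × b ∈ H
  traversed-bwd b∈ with p , p∈ , refl ← ∈-map⁻ proj₂ b∈
    = let t = All.lookup (steps-traversed trace) p∈ in head⇝v t , bwd-arc t

  new-pairs-related : All (Related H) new-pairs
  new-pairs-related = All.tabulate related
    where
    related : ∀ {b f} → (b , f) ∈ new-pairs → Related H (b , f)
    related x∈ with b∈ , f∈ , _ ← ∈-inversions⁻ {steps trace} x∈
      with b⇝v , b∈H ← traversed-bwd b∈ | w⇝f , f∈H ← traversed-fwd f∈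
      = b∈H , f∈H , b⇝v ◅◅ here refl ◅ w⇝f

  -- In a topological order a path never goes backwards, but an inverted pair would need one.
  new-pairs-unrelated : ∀ {b f} → (b , f) ∈ new-pairs → ¬ Related G (b , f)
  new-pairs-unrelated x∈ (_ , _ , path) with _ , _ , inverted ← ∈-inversions⁻ {steps trace} x∈
    = <⇒≱ inverted (Reach⇒position≤ topo path)

  many-new-pairs : k * k ≤ 2 * length new-pairs
  many-new-pairs = subst (λ l → l * l ≤ 2 * length new-pairs) (length-steps trace)
    (length²≤2*inversions (steps trace) (All.map compatible (steps-traversed trace)))

sumOfSquares : List ℕ → ℕ
sumOfSquares []       = 0
sumOfSquares (k ∷ ks) = k * k + sumOfSquares ks

2*m*n≤m*m+n*n : ∀ m n → 2 * m * n ≤ m * m + n * n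
2*m*n≤m*m+n*n zero    n       = z≤n
2*m*n≤m*m+n*n (suc m) zero    = ≤-trans (≤-reflexive (*-zeroʳ (2 * suc m))) z≤n
2*m*n≤m*m+n*n (suc m) (suc n) = begin
  2 * suc m * suc n                          ≡⟨ expand m n ⟩
  2 * m * n + (2 * m + 2 * n + 2)            ≤⟨ +-monoˡ-≤ _ (2*m*n≤m*m+n*n m n) ⟩
  m * m + n * n + (2 * m + 2 * n + 2)        ≡⟨ collect m n ⟩
  suc m * suc m + suc n * suc n              ∎
  where
  open ≤-Reasoning
  expand : ∀ m n → 2 * suc m * suc n ≡ 2 * m * n + (2 * m + 2 * n + 2)
  expand = solve-∀
  collect : ∀ m n → m * m + n * n + (2 * m + 2 * n + 2) ≡ suc m * suc m + suc n * suc n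
  collect = solve-∀

cauchy-schwarz : ∀ ks → sum ks * sum ks ≤ length ks * sumOfSquares ks
cauchy-schwarz []       = z≤n
cauchy-schwarz (k ∷ ks) = begin
  (k + S) * (k + S)
    ≡⟨ expand k S ⟩
  k * k + (2 * k * S + S * S)
    ≤⟨ +-monoʳ-≤ (k * k) (+-mono-≤ (cross ks) (cauchy-schwarz ks)) ⟩
  k * k + ((Σ² + length ks * (k * k)) + length ks * Σ²)
    ≡⟨ collect k Σ² (length ks) ⟩
  suc (length ks) * (k * k + Σ²)
    ∎
  where
  open ≤-Reasoning
  S Σ² : ℕ
  S = sum ks
  Σ² = sumOfSquares ks
  cross : ∀ js → 2 * k * sum js ≤ sumOfSquares js + length js * (k * k)
  cross []       = ≤-reflexive (*-zeroʳ (2 * k))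
  cross (j ∷ js) = begin
    2 * k * (j + sum js)                                          ≡⟨ *-distribˡ-+ (2 * k) j (sum js) ⟩
    2 * k * j + 2 * k * sum js                                    ≤⟨ +-mono-≤ (2*m*n≤m*m+n*n k j) (cross js) ⟩
    k * k + j * j + (sumOfSquares js + length js * (k * k))       ≡⟨ regroup k j (sumOfSquares js) (length js) ⟩
    j * j + sumOfSquares js + suc (length js) * (k * k)           ∎
    where
    regroup : ∀ k j q r → k * k + j * j + (q + r * (k * k)) ≡ j * j + q + suc r * (k * k)
    regroup = solve-∀
  expand : ∀ k s → (k + s) * (k + s) ≡ k * k + (2 * k * s + s * s)
  expand = solve-∀
  collect : ∀ k q r → k * k + ((q + r * (k * k)) + r * q) ≡ suc r * (k * k + q)
  collect = solve-∀

cost-bound : ∀ m ks → length ks ≤ m → sumOfSquares ks ≤ 2 * (m * m) →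
             (sum ks + sum ks) * (sum ks + sum ks) ≤ 8 * (m * m * m)
cost-bound m ks searches squares = begin
  (S + S) * (S + S)               ≡⟨ double² S ⟩
  4 * (S * S)                     ≤⟨ *-monoʳ-≤ 4 (cauchy-schwarz ks) ⟩
  4 * (length ks * sumOfSquares ks) ≤⟨ *-monoʳ-≤ 4 (*-mono-≤ searches squares) ⟩
  4 * (m * (2 * (m * m)))         ≡⟨ cube m ⟩
  8 * (m * m * m)                 ∎
  where
  open ≤-Reasoning
  S : ℕ
  S = sum ks
  double² : ∀ s → (s + s) * (s + s) ≡ 4 * (s * s)
  double² = solve-∀
  cube : ∀ m → 4 * (m * (2 * (m * m))) ≡ 8 * (m * m * m)
  cube = solve-∀

squares-step : ∀ {k f p q b} → k * k ≤ 2 * f → q + 2 * (f + p) ≤ b → k * k + q + 2 * p ≤ b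
squares-step {k} {f} {p} {q} k²≤2f bound = begin
  k * k + q + 2 * p   ≤⟨ +-monoˡ-≤ (2 * p) (+-monoˡ-≤ q k²≤2f) ⟩
  2 * f + q + 2 * p   ≡⟨ regroup f q p ⟩
  q + 2 * (f + p)     ≤⟨ bound ⟩
  _                   ∎
  where
  open ≤-Reasoning
  regroup : ∀ f q p → 2 * f + q + 2 * p ≡ q + 2 * (f + p)
  regroup = solve-∀

Unique⇒length≤ : ∀ {xs ys : List A} → Unique xs → (∀ {x} → x ∈ xs → x ∈ ys) → length xs ≤ length ys
Unique⇒length≤ {xs = []}     _          _   = z≤n
Unique⇒length≤ {xs = x ∷ xs} (x∉ ∷ u) xs⊆ys with y₁ , y₂ , refl ← ∈-∃++ (xs⊆ys (here refl)) = begin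
  suc (length xs)            ≤⟨ s≤s (Unique⇒length≤ u xs⊆y₁y₂) ⟩
  suc (length (y₁ ++ y₂))    ≡⟨ cong suc (length-++ y₁) ⟩
  suc (length y₁ + length y₂) ≡⟨ sym (+-suc (length y₁) (length y₂)) ⟩
  length y₁ + length (x ∷ y₂) ≡⟨ sym (length-++ y₁) ⟩
  length (y₁ ++ x ∷ y₂)      ∎
  where
  open ≤-Reasoning
  xs⊆y₁y₂ : ∀ {z} → z ∈ xs → z ∈ y₁ ++ y₂
  xs⊆y₁y₂ z∈xs with ∈-++⁻ y₁ (xs⊆ys (there z∈xs))
  ... | inj₁ z∈y₁         = ∈-++⁺ˡ z∈y₁
  ... | inj₂ (here refl)  = ⊥-elim (All.lookup x∉ z∈xs refl)
  ... | inj₂ (there z∈y₂) = ∈-++⁺ʳ y₁ z∈y₂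

length-cartesianProduct : ∀ (xs : List A) (ys : List B) →
                          length (cartesianProduct xs ys) ≡ length xs * length ys
length-cartesianProduct []       ys = refl
length-cartesianProduct (x ∷ xs) ys = trans (length-++ (map (x ,_) ys))
  (cong₂ _+_ (length-map (x ,_) ys) (length-cartesianProduct xs ys))

module _ {n : ℕ} where

  related-bound : ∀ {G : List (Arc n)} {Ps} → Unique Ps → All (Related G) Ps → length Ps ≤ length G * length G
  related-bound {G} {Ps} uPs rPs = ≤-trans (Unique⇒length≤ uPs Ps⊆G×G) (≤-reflexive (length-cartesianProduct G G))
    where
    Ps⊆G×G : ∀ {p} → p ∈ Ps → p ∈ cartesianProduct G G
    Ps⊆G×G p∈ with e∈ , f∈ , _ ← All.lookup rPs p∈ = ∈-cartesianProduct⁺ e∈ f∈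

  OutcomeTopological : Outcome n → List (Arc n) → Set
  OutcomeTopological (continue o′) G = TopologicalOrder o′ G
  OutcomeTopological cycle         G = ⊤

  record ProcessBound (G : List (Arc n)) (a : Arc n) (r : Outcome n) (c : ℕ)
                      (Ps : List (Arc n × Arc n)) : Set where
    field
      steps      : ℕ
      cost       : c ≡ steps + steps
      fresh      : List (Arc n × Arc n)
      unique     : Unique (fresh ++ Ps)
      related    : All (Related (a ∷ G)) (fresh ++ Ps)
      many-fresh : steps * steps ≤ 2 * length fresh
      outcome    : OutcomeTopological r (a ∷ G)

  search-bound : ∀ {o G v w st k r Ps} → TopologicalOrder o G →
                 Search ((v , w) ∷ G) o v w (initSState v w) st k → Unique Ps → All (Related G) Ps →
                 OutcomeTopological r ((v , w) ∷ G) → ProcessBound G (v , w) r (k + k) Ps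
  search-bound {k = k} topo search uPs rPs out = record
    { steps      = k
    ; cost       = refl
    ; fresh      = new-pairs
    ; unique     = Unique-++⁺ new-pairs-unique uPs λ (x∈new , x∈Ps) →
                     new-pairs-unrelated x∈new (All.lookup rPs x∈Ps)
    ; related    = All-++⁺ new-pairs-related (All.map Related-∷ rPs)
    ; many-fresh = many-new-pairs
    ; outcome    = out
    }
    where open NewPairs topo search

  process-bound : ∀ {o G a r c Ps} → Process o G a r c → TopologicalOrder o G →
                  Unique Ps → All (Related G) Ps → ProcessBound G a r c Ps
  process-bound (forwardArc v<w) (uo , arcs) uPs rPs = record
    { steps = 0 ; cost = refl ; fresh = [] ; unique = uPs ; related = All.map Related-∷ rPs ; many-fresh = z≤n
    ; outcome = uo , λ { (here refl) → v<w ; (there e) → arcs e } }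
  process-bound selfLoop _ uPs rPs = record
    { steps = 0 ; cost = refl ; fresh = [] ; unique = uPs ; related = All.map Related-∷ rPs ; many-fresh = z≤n
    ; outcome = tt }
  process-bound (searchCycle _ search _) topo uPs rPs = search-bound topo search uPs rPs tt
  process-bound {G = G} (searchReorder {v = v} {w} w<v search no-cycle sep reorder) topo uPs rPs =
    search-bound topo search uPs rPs
      (Reordering.reorder-topological topo w<v (search-invariant search initial-invariant) no-cycle sep reorder)
    where open SearchTrace ((v , w) ∷ G) _ v w

  record RunBound (G as : List (Arc n)) (c : ℕ) (Ps : List (Arc n × Arc n)) : Set where
    field
      searches     : List ℕ
      few-searches : length searches ≤ length as
      cost         : c ≡ sum searches + sum searches
      squares      : sumOfSquares searches + 2 * length Ps ≤
                     2 * ((length as + length G) * (length as + length G))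

  run-bound : ∀ {o G as c Ps} → Run o G as c → TopologicalOrder o G →
              Unique Ps → All (Related G) Ps → RunBound G as c Ps
  run-bound finish _ uPs rPs = record
    { searches = [] ; few-searches = z≤n ; cost = refl ; squares = *-monoʳ-≤ 2 (related-bound uPs rPs) }
  run-bound {G = G} {Ps = Ps} (next {as = as} p run) topo uPs rPs = record
    { searches     = steps ∷ RB.searches
    ; few-searches = s≤s RB.few-searches
    ; cost         = trans (cong₂ _+_ cost RB.cost) (+-exchange steps steps (sum RB.searches) _)
    ; squares      = squares-step {steps} {length fresh} {length Ps} {sumOfSquares RB.searches} many-fresh later
    }
    where
    open ProcessBound (process-bound p topo uPs rPs)
    module RB = RunBound (run-bound run outcome unique related)
    m : ℕ
    m = suc (length as) + length G
    later : sumOfSquares RB.searches + 2 * (length fresh + length Ps) ≤ 2 * (m * m)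
    later = subst₂ (λ l l′ → sumOfSquares RB.searches + 2 * l ≤ 2 * (l′ * l′))
                   (length-++ fresh) (+-suc (length as) (length G)) RB.squares
  run-bound {G = G} {Ps = Ps} (halt p) topo uPs rPs = record
    { searches     = steps ∷ []
    ; few-searches = ≤-refl
    ; cost         = trans cost (sym (cong₂ _+_ (+-identityʳ steps) (+-identityʳ steps)))
    ; squares      = squares-step {steps} {length fresh} {length Ps} {0} many-fresh all-pairs
    }
    where
    open ProcessBound (process-bound p topo uPs rPs)
    all-pairs : 0 + 2 * (length fresh + length Ps) ≤ 2 * (suc (length G) * suc (length G))
    all-pairs = subst (λ l → 2 * l ≤ 2 * (suc (length G) * suc (length G))) (length-++ fresh)
                      (*-monoʳ-≤ 2 (related-bound unique related))

lemma2 : ∃ λ (C : ℕ) → ∀ (n : ℕ) (o : List (Fin n)) → o ↭ allFin n →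
           ∀ (as : List (Arc n)) (c : ℕ) → Run o [] as c →
           c * c ≤ C * (length as * length as * length as)
lemma2 = 8 , λ n o o↭ as c run →
  let open RunBound (run-bound run (Unique-resp-↭ (↭-sym o↭) (allFin⁺ n) , λ ()) [] [])
      m : ℕ
      m = length as
      squares′ : sumOfSquares searches ≤ 2 * (m * m)
      squares′ = ≤-trans (m≤m+n _ 0)
                   (subst (λ l → sumOfSquares searches + 0 ≤ 2 * (l * l)) (+-identityʳ m) squares)
  in subst (λ c → c * c ≤ 8 * (m * m * m)) (sym cost) (cost-bound m searches few-searches squares′)
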